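{- Let $\mathbf{e}$ be a transitive relation on a set $E$. The following are equivalent: (i) $\mathbf{e}$ is square-free; (ii) $\mathrm{Clop}(\mathbf{e})=\mathrm{Reg}(\mathbf{e})$; (iii) $\mathrm{Clop}(\mathbf{e})$ is a lattice; (iv) $\mathrm{Clop}(\mathbf{e})$ has the interpolation property: for all $\mathbf{x}_0,\mathbf{x}_1,\mathbf{y}_0,\mathbf{y}_1\in\mathrm{Clop}(\mathbf{e})$ such that $\mathbf{x}_i\subseteq\mathbf{y}_j$ for all $i,j\in\{0,1\}$, there exists $\mathbf{z}\in\mathrm{Clop}(\mathbf{e})$ with $\mathbf{x}_i\subseteq\mathbf{z}\subseteq\mathbf{y}_i$ for all $i\in\{0,1\}$.
   Context: A transitive relation $\mathbf{e}$ on $E$ is viewed as a set of ordered pairs. Write $x\lhd y$ if $(x,y)\in\mathbf{e}$ and $x\unlhd y$ if ($x\lhd y$ or $x=y$). For $a,b\in E$ let $[a,b]=\{x\in E: a\unlhd x\unlhd b\}$. $\mathbf{e}$ is square-free if for every $(a,b)\in\mathbf{e}$, any two elements $x,y\in[a,b]$ satisfy $x\unlhd y$ or $y\unlhd x$. A subset $\mathbf{a}\subseteq\mathbf{e}$ is closed if transitive, open if $\mathbf{e}\setminus\mathbf{a}$ is transitive, clopen if both. $\mathrm{cl}$ is transitive closure, $\mathrm{int}(\mathbf{a})$ the largest open subset of $\mathbf{a}$; $\mathbf{a}$ is regular closed if $\mathbf{a}=\mathrm{cl}(\mathrm{int}(\mathbf{a}))$. $\mathrm{Clop}(\mathbf{e})$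 (resp. $\mathrm{Reg}(\mathbf{e})$) is the set of clopen (resp. regular closed) subsets of $\mathbf{e}$ ordered by inclusion. -}

module Defs where

open import Level using (Level; 0ℓ) renaming (suc to lsuc)
open import Data.Product using (Σ; ∃; _×_; _,_)
open import Data.Sum using (_⊎_)
open import Relation.Nullary using (¬_)
open import Relation.Binary using (Rel; Transitive; _⇒_)
open import Relation.Binary.PropositionalEquality using (_≡_)
open import Relation.Binary.Construct.Closure.Transitive using (TransClosure)
open import Function.Bundles using (_⇔_)

Relation : Set → Set₁
Relation E = Rel E 0ℓ

module _ {E : Set} where

  Refl⊴ : Relation E → E → E → Set
  Refl⊴ e x y = e x y ⊎ x ≡ y

  SquareFree : Relation E → Set
  SquareFree e = ∀ {a b} → e a b → ∀ x y →
    Refl⊴ e a x → Refl⊴ e x b → Refl⊴ e a y → Refl⊴ e y b →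
    Refl⊴ e x y ⊎ Refl⊴ e y x

  Diff : ∀ {ℓ} → Relation E → Rel E ℓ → Rel E ℓ
  Diff e a x y = e x y × ¬ a x y

  Closed : ∀ {ℓ} → Rel E ℓ → Set ℓ
  Closed a = Transitive a

  Open : ∀ {ℓ} → Relation E → Rel E ℓ → Set ℓ
  Open e a = Transitive (Diff e a)

  Clopen : Relation E → Relation E → Set
  Clopen e a = Closed a × Open e a

  cl : ∀ {ℓ} → Rel E ℓ → Rel E ℓ
  cl a = TransClosure a

  int : Relation E → Relation E → Rel E (lsuc 0ℓ)
  int e a x y = Σ (Relation E) λ c → c ⇒ a × Open e c × c x y

  RegClosed : Relation E → Relation E → Set₁
  RegClosed e a = (a ⇒ cl (int e a)) × (cl (int e a) ⇒ a)

  ClopEqReg : Relation E → Set₁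
  ClopEqReg e = ∀ (a : Relation E) → a ⇒ e → (Clopen e a ⇔ RegClosed e a)

  InClop : Relation E → Relation E → Set
  InClop e a = (a ⇒ e) × Clopen e a

  ClopLattice : Relation E → Set₁
  ClopLattice e = ∀ (x y : Relation E) → InClop e x → InClop e y →
    (Σ (Relation E) λ z → InClop e z × (x ⇒ z) × (y ⇒ z) ×
       (∀ (w : Relation E) → InClop e w → x ⇒ w → y ⇒ w → z ⇒ w))
    × (Σ (Relation E) λ z → InClop e z × (z ⇒ x) × (z ⇒ y) ×
       (∀ (w : Relation E) → InClop e w → w ⇒ x → w ⇒ y → w ⇒ z))

  ClopInterpolation : Relation E → Set₁
  ClopInterpolation e = ∀ (x₀ x₁ y₀ y₁ : Relation E) →
    InClop e x₀ → InClop e x₁ → InClop e y₀ → InClop e y₁ →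
    x₀ ⇒ y₀ → x₀ ⇒ y₁ → x₁ ⇒ y₀ → x₁ ⇒ y₁ →
    Σ (Relation E) λ z → InClop e z ×
      (x₀ ⇒ z) × (z ⇒ y₀) × (x₁ ⇒ z) × (z ⇒ y₁)

module Submission where

-- * Openness is reformulated (classically) as "split-openness": a ⊆ e is
--   open iff whenever u ◁ v ◁ w and (u,w) ∈ a, then (u,v) ∈ a or (v,w) ∈ a.
-- * Key lemma: if e is square-free, the transitive closure of a
--   split-open subset of e is again split-open.  Hence cl of an open set
--   is clopen, which gives (i) ⇒ (ii) (a regular closed set is cl of its
--   open interior) and (i) ⇒ (iii) (the join of p, q is cl (p ∪ q), the
--   meet is the complement of the join of the complements).
-- * (iii) ⇒ (iv) is immediate: interpolate with the join of x₀, x₁.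
-- * For the converses, a failure of square-freeness yields a "square"
--   a ◁ x, y ◁ b with x, y incomparable.  The sets Into x (edges entering
--   the cluster of x from strictly below) and OutOf x (edges leaving it
--   strictly upwards) are clopen; cl (Into x ∪ OutOf x) is regular closed
--   but not open, refuting (ii), and the four sets Into x, OutOf x,
--   e ∖ Into y, e ∖ OutOf y admit no clopen interpolant, refuting (iv).

open import Defs
open import Level using (0ℓ; suc)
open import Function using (id)
open import Data.Product using (_×_; _,_; proj₁; proj₂)
open import Data.Sum using (_⊎_; inj₁; inj₂) renaming ([_,_] to either)
open import Data.Empty using (⊥-elim)
open import Relation.Nullary using (¬_; yes; no; contradiction)
open import Relation.Binary using (Transitive; Rel; _⇒_)
open import Relation.Binary.PropositionalEquality using (refl)
open import Relation.Binary.Construct.Union using (_∪_)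
open import Relation.Binary.Construct.Closure.Transitive using ([_]; _∷_; _++_)
open import Function.Bundles using (_⇔_; mk⇔; Equivalence)
open import Axiom.ExcludedMiddle using (ExcludedMiddle)

module SquareFreeness {E : Set} (e : Relation E) (trans : Transitive e) where

  infix 4 _◁_ _⊴_ _≺_ _∼_

  _◁_ : E → E → Set
  _◁_ = e

  _⊴_ : E → E → Set
  _⊴_ = Refl⊴ e

  _≺_ : E → E → Set
  u ≺ v = u ◁ v × ¬ v ◁ u

  _∼_ : E → E → Set
  u ∼ v = u ⊴ v × v ⊴ u

  ⊴-◁-trans : ∀ {u v w} → u ⊴ v → v ◁ w → u ◁ w
  ⊴-◁-trans (inj₁ u◁v) v◁w = trans u◁v v◁w
  ⊴-◁-trans (inj₂ refl) v◁w = v◁w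

  ◁-⊴-trans : ∀ {u v w} → u ◁ v → v ⊴ w → u ◁ w
  ◁-⊴-trans u◁v (inj₁ v◁w) = trans u◁v v◁w
  ◁-⊴-trans u◁v (inj₂ refl) = u◁v

  ⊴-trans : ∀ {u v w} → u ⊴ v → v ⊴ w → u ⊴ w
  ⊴-trans (inj₁ u◁v) v⊴w = inj₁ (◁-⊴-trans u◁v v⊴w)
  ⊴-trans (inj₂ refl) v⊴w = v⊴w

  ≺⇒⋭ : ∀ {u v} → u ≺ v → ¬ v ⊴ u
  ≺⇒⋭ (_ , v⋪u) (inj₁ v◁u) = v⋪u v◁u
  ≺⇒⋭ (u◁v , v⋪u) (inj₂ refl) = v⋪u u◁v

  cl-least : ∀ {ℓ ℓ′} {r : Rel E ℓ} {b : Rel E ℓ′} → r ⇒ b → Transitive b → cl r ⇒ b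
  cl-least r⇒b tb [ r-uv ] = r⇒b r-uv
  cl-least r⇒b tb (r-uv ∷ rest) = tb (r⇒b r-uv) (cl-least r⇒b tb rest)

  cl-mono : ∀ {ℓ ℓ′} {r : Rel E ℓ} {s : Rel E ℓ′} → r ⇒ s → cl r ⇒ cl s
  cl-mono r⇒s = cl-least (λ r-uv → [ r⇒s r-uv ]) _++_

  Diff-antitone : ∀ {ℓ ℓ′} {p : Rel E ℓ} {q : Rel E ℓ′} → p ⇒ q → Diff e q ⇒ Diff e p
  Diff-antitone p⇒q (u◁v , ¬q) = u◁v , λ p-uv → ¬q (p⇒q p-uv)

  Diff-reflect : ExcludedMiddle 0ℓ → {p q : Relation E} → Diff e p ⇒ q → Diff e q ⇒ p
  Diff-reflect lem {p} {q} ∁p⇒q {u} {v} (u◁v , ¬q) with lem {p u v}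
  ... | yes p-uv = p-uv
  ... | no ¬p = contradiction (∁p⇒q (u◁v , ¬p)) ¬q

  open-≐ : ∀ {ℓ ℓ′} {a : Rel E ℓ} {b : Rel E ℓ′} → a ⇒ b → b ⇒ a → Open e a → Open e b
  open-≐ {a = a} {b} a⇒b b⇒a open-a d₁ d₂ = ∁a⇒∁b (open-a (∁b⇒∁a d₁) (∁b⇒∁a d₂))
    where
    ∁a⇒∁b : Diff e a ⇒ Diff e b
    ∁a⇒∁b = Diff-antitone {p = b} {q = a} b⇒a
    ∁b⇒∁a : Diff e b ⇒ Diff e a
    ∁b⇒∁a = Diff-antitone {p = a} {q = b} a⇒b

  disjoint⇒⊆∁ : {c d : Relation E} → c ⇒ e → (∀ {u v} → c u v → ¬ d u v) → c ⇒ Diff e d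
  disjoint⇒⊆∁ c⊆e disjoint c-uv = c⊆e c-uv , disjoint c-uv

  int-⊆ : {a : Relation E} → int e a ⇒ a
  int-⊆ (_ , c⇒a , _ , c-uv) = c⇒a c-uv

  int-largest : {a c : Relation E} → c ⇒ a → Open e c → c ⇒ int e a
  int-largest c⇒a open-c c-uv = _ , c⇒a , open-c , c-uv

  -- A union of open sets is open: in particular the interior, and p ∪ q.
  int-open : (a : Relation E) → Open e (int e a)
  int-open a d₁ d₂ = trans (proj₁ d₁) (proj₁ d₂) , λ { (c , c⇒a , open-c , c-uw) →
    let shrink = Diff-antitone (int-largest c⇒a open-c)
    in proj₂ (open-c (shrink d₁) (shrink d₂)) c-uw }

  ∪-open : {p q : Relation E} → Open e p → Open e q → Open e (p ∪ q)
  ∪-open {p} {q} open-p open-q d₁ d₂ = trans (proj₁ d₁) (proj₁ d₂) ,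
    either (proj₂ (open-p (left d₁) (left d₂))) (proj₂ (open-q (right d₁) (right d₂)))
    where
    left : Diff e (p ∪ q) ⇒ Diff e p
    left = Diff-antitone {p = p} {q = p ∪ q} inj₁
    right : Diff e (p ∪ q) ⇒ Diff e q
    right = Diff-antitone {p = q} {q = p ∪ q} inj₂

  ∁-clop : ExcludedMiddle 0ℓ → {c : Relation E} → InClop e c → InClop e (Diff e c)
  ∁-clop lem {c} (_ , closed-c , open-c) = proj₁ , open-c , open-∁
    where
    ∁∁⇒c : Diff e (Diff e c) ⇒ c
    ∁∁⇒c = Diff-reflect lem {c} {Diff e c} id
    open-∁ : Open e (Diff e c)
    open-∁ d₁ d₂ = trans (proj₁ d₁) (proj₁ d₂) ,
      λ ∁c-uw → proj₂ ∁c-uw (closed-c (∁∁⇒c d₁) (∁∁⇒c d₂))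

  cl-open-regular : {c : Relation E} → Open e c → RegClosed e (cl c)
  cl-open-regular open-c = cl-mono (int-largest [_] open-c) , cl-least int-⊆ _++_

  clopen⇒regular : {a : Relation E} → Clopen e a → RegClosed e a
  clopen⇒regular (closed-a , open-a) =
    (λ a-uv → [ int-largest id open-a a-uv ]) , cl-least int-⊆ closed-a

  SplitOpen : ∀ {ℓ} → Rel E ℓ → Set ℓ
  SplitOpen o = ∀ {u v w} → u ◁ v → v ◁ w → o u w → o u v ⊎ o v w

  splitOpen⇒open : ∀ {ℓ} {o : Rel E ℓ} → SplitOpen o → Open e o
  splitOpen⇒open split (u◁v , ¬o-uv) (v◁w , ¬o-vw) =
    trans u◁v v◁w , λ o-uw → either ¬o-uv ¬o-vw (split u◁v v◁w o-uw)

  open⇒splitOpen : ∀ {ℓ} {o : Rel E ℓ} → ExcludedMiddle ℓ → Open e o → SplitOpen o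
  open⇒splitOpen {o = o} lem open-o {u} {v} {w} u◁v v◁w o-uw with lem {o u v} | lem {o v w}
  ... | yes o-uv | _ = inj₁ o-uv
  ... | no _ | yes o-vw = inj₂ o-vw
  ... | no ¬o-uv | no ¬o-vw = contradiction o-uw (proj₂ (open-o (u◁v , ¬o-uv) (v◁w , ¬o-vw)))

  -- For a path u o z ⋯ w and u ◁ v ◁ w, the points v, z of [u, w] are
  -- comparable; split the first step if v ◁ z, recurse on the rest if z ◁ v.
  cl-splitOpen : ∀ {ℓ} {o : Rel E ℓ} → SquareFree e → o ⇒ e → SplitOpen o → SplitOpen (cl o)
  cl-splitOpen sf o⊆e split u◁v v◁w [ o-uw ] =
    either (λ o-uv → inj₁ [ o-uv ]) (λ o-vw → inj₂ [ o-vw ]) (split u◁v v◁w o-uw)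
  cl-splitOpen sf o⊆e split {v = v} u◁v v◁w (_∷_ {y = z} o-uz z⇝w)
    with sf (trans u◁v v◁w) v z (inj₁ u◁v) (inj₁ v◁w) (inj₁ (o⊆e o-uz))
            (inj₁ (cl-least o⊆e trans z⇝w))
  ... | inj₁ (inj₂ refl) = inj₁ [ o-uz ]
  ... | inj₂ (inj₂ refl) = inj₁ [ o-uz ]
  ... | inj₁ (inj₁ v◁z) =
    either (λ o-uv → inj₁ [ o-uv ]) (λ o-vz → inj₂ (o-vz ∷ z⇝w)) (split u◁v v◁z o-uz)
  ... | inj₂ (inj₁ z◁v) =
    either (λ z⇝v → inj₁ (o-uz ∷ z⇝v)) inj₂ (cl-splitOpen sf o⊆e split z◁v v◁w z⇝w)

  cl-open : ∀ {ℓ} {o : Rel E ℓ} → ExcludedMiddle ℓ → SquareFree e →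
            o ⇒ e → Open e o → Open e (cl o)
  cl-open lem sf o⊆e open-o =
    splitOpen⇒open (cl-splitOpen sf o⊆e (open⇒splitOpen lem open-o))

  squareFree⇒clopEqReg : ExcludedMiddle (suc 0ℓ) → SquareFree e → ClopEqReg e
  squareFree⇒clopEqReg lem sf a a⊆e = mk⇔ clopen⇒regular regular⇒clopen
    where
    regular⇒clopen : RegClosed e a → Clopen e a
    regular⇒clopen (a⇒clint , clint⇒a) =
      (λ a-uv a-vw → clint⇒a (a⇒clint a-uv ++ a⇒clint a-vw)) ,
      open-≐ clint⇒a a⇒clint (cl-open lem sf (λ i → a⊆e (int-⊆ i)) (int-open a))

  join-clop : ExcludedMiddle 0ℓ → SquareFree e → {p q : Relation E} →
              InClop e p → InClop e q → InClop e (cl (p ∪ q))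
  join-clop lem sf (p⊆e , _ , open-p) (q⊆e , _ , open-q) =
    cl-least (either p⊆e q⊆e) trans , _++_ ,
    cl-open lem sf (either p⊆e q⊆e) (∪-open open-p open-q)

  squareFree⇒clopLattice : ExcludedMiddle 0ℓ → SquareFree e → ClopLattice e
  squareFree⇒clopLattice lem sf p q clop-p clop-q =
    (cl (p ∪ q) , join-clop lem sf clop-p clop-q , (λ z → [ inj₁ z ]) , (λ z → [ inj₂ z ]) ,
      λ w clop-w p⇒w q⇒w → cl-least (either p⇒w q⇒w) (proj₁ (proj₂ clop-w)))
    , (Diff e ∁join ,
      ∁-clop lem (join-clop lem sf (∁-clop lem clop-p) (∁-clop lem clop-q)) ,
      Diff-reflect lem {p} {∁join} (λ d → [ inj₁ d ]) ,
      Diff-reflect lem {q} {∁join} (λ d → [ inj₂ d ]) , below-meet)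
    where
    ∁join : Relation E
    ∁join = cl (Diff e p ∪ Diff e q)
    below-meet : ∀ (w : Relation E) → InClop e w → w ⇒ p → w ⇒ q → w ⇒ Diff e ∁join
    below-meet w (w⊆e , _ , open-w) w⇒p w⇒q w-uv = w⊆e w-uv , λ ∁join-uv →
      proj₂ (∁join⇒∁w ∁join-uv) w-uv
      where
      -- e ∖ w is transitive and contains both complements.
      ∁join⇒∁w : ∁join ⇒ Diff e w
      ∁join⇒∁w = cl-least {r = Diff e p ∪ Diff e q}
        (either (Diff-antitone {p = w} w⇒p) (Diff-antitone {p = w} w⇒q)) open-w

  clopLattice⇒clopInterpolation : ClopLattice e → ClopInterpolation e
  clopLattice⇒clopInterpolation L x₀ x₁ y₀ y₁ c₀ c₁ d₀ d₁ x₀y₀ x₀y₁ x₁y₀ x₁y₁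
    with proj₁ (L x₀ x₁ c₀ c₁)
  ... | z , clop-z , x₀⇒z , x₁⇒z , least =
    z , clop-z , x₀⇒z , least y₀ d₀ x₀y₀ x₁y₀ , x₁⇒z , least y₁ d₁ x₀y₁ x₁y₁

  record Square : Set where
    field
      {a b x y} : E
      a◁x : a ◁ x
      x◁b : x ◁ b
      a◁y : a ◁ y
      y◁b : y ◁ b
      x⋬y : ¬ x ⊴ y
      y⋬x : ¬ y ⊴ x

  noSquare⇒squareFree : ExcludedMiddle 0ℓ → ¬ Square → SquareFree e
  noSquare⇒squareFree lem noSquare {a} {b} _ x y a⊴x x⊴b a⊴y y⊴b
    with lem {x ⊴ y ⊎ y ⊴ x}
  ... | yes comparable = comparable
  ... | no incomparable = ⊥-elim (noSquare (record
          { a◁x = strictlyAbove a⊴x a⊴y x⋬y ; x◁b = strictlyBelow x⊴b y⊴b y⋬x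
          ; a◁y = strictlyAbove a⊴y a⊴x y⋬x ; y◁b = strictlyBelow y⊴b x⊴b x⋬y
          ; x⋬y = x⋬y ; y⋬x = y⋬x }))
    where
    x⋬y : ¬ x ⊴ y
    x⋬y x⊴y = incomparable (inj₁ x⊴y)
    y⋬x : ¬ y ⊴ x
    y⋬x y⊴x = incomparable (inj₂ y⊴x)
    -- s cannot be a itself when a ⊴ t but s ⋬ t; dually for b.
    strictlyAbove : ∀ {s t} → a ⊴ s → a ⊴ t → ¬ s ⊴ t → a ◁ s
    strictlyAbove (inj₁ a◁s) _ _ = a◁s
    strictlyAbove (inj₂ refl) a⊴t s⋬t = contradiction a⊴t s⋬t
    strictlyBelow : ∀ {s t} → s ⊴ b → t ⊴ b → ¬ t ⊴ s → s ◁ b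
    strictlyBelow (inj₁ s◁b) _ _ = s◁b
    strictlyBelow (inj₂ refl) t⊴b t⋬s = contradiction t⊴b t⋬s

  Into : E → Relation E
  Into p u v = u ◁ v × u ≺ p × v ∼ p

  OutOf : E → Relation E
  OutOf p u v = u ◁ v × u ∼ p × p ≺ v

  -- Into p is closed (vacuously: an Into-edge ends in the cluster of p, so
  -- no Into-edge starts there) and open.
  Into-clop : ∀ p → InClop e (Into p)
  Into-clop p = proj₁ , closed , open-Into
    where
    closed : Transitive (Into p)
    closed (_ , _ , v∼p) (_ , v≺p , _) = ⊥-elim (≺⇒⋭ v≺p (proj₂ v∼p))
    -- If u → w enters the cluster, then v ◁ p; either v ∼ p and u → v
    -- enters, or v ≺ p and v → w enters.
    open-Into : Open e (Into p)
    open-Into (u◁v , ¬into-uv) (v◁w , ¬into-vw) = trans u◁v v◁w ,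
      λ (_ , u≺p , w⊴p , p⊴w) →
        let v◁p = ◁-⊴-trans v◁w w⊴p
        in ¬into-vw (v◁w , (v◁p , λ p◁v → ¬into-uv (u◁v , u≺p , inj₁ v◁p , inj₁ p◁v)) ,
                     w⊴p , p⊴w)

  OutOf-clop : ∀ p → InClop e (OutOf p)
  OutOf-clop p = proj₁ , closed , open-OutOf
    where
    closed : Transitive (OutOf p)
    closed (_ , _ , p≺v) (_ , v∼p , _) = ⊥-elim (≺⇒⋭ p≺v (proj₁ v∼p))
    open-OutOf : Open e (OutOf p)
    open-OutOf (u◁v , ¬out-uv) (v◁w , ¬out-vw) = trans u◁v v◁w ,
      λ (_ , (u⊴p , p⊴u) , p≺w) →
        let p◁v = ⊴-◁-trans p⊴u u◁v
        in ¬out-uv (u◁v , (u⊴p , p⊴u) ,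
                    (p◁v , λ v◁p → ¬out-vw (v◁w , (inj₁ v◁p , inj₁ p◁v) , p≺w)))

  -- An edge determines its cluster: sets for incomparable points are disjoint.
  Into-Into : ∀ {p q u v} → Into p u v → Into q u v → p ⊴ q
  Into-Into (_ , _ , _ , p⊴v) (_ , _ , v⊴q , _) = ⊴-trans p⊴v v⊴q

  OutOf-OutOf : ∀ {p q u v} → OutOf p u v → OutOf q u v → p ⊴ q
  OutOf-OutOf (_ , (_ , p⊴u) , _) (_ , (u⊴q , _) , _) = ⊴-trans p⊴u u⊴q

  Into-OutOf : ∀ {p q u v} → Into p u v → OutOf q u v → q ◁ p
  Into-OutOf (_ , (u◁p , _) , _) (_ , (_ , q⊴u) , _) = ⊴-◁-trans q⊴u u◁p

  module _ (sq : Square) where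
    open Square sq

    into-x : Into x a x
    into-x = a◁x , (a◁x , λ x◁a → x⋬y (inj₁ (trans x◁a a◁y))) , inj₂ refl , inj₂ refl

    outOf-x : OutOf x x b
    outOf-x = x◁b , (inj₂ refl , inj₂ refl) , x◁b , λ b◁x → y⋬x (inj₁ (trans y◁b b◁x))

    into-y : Into y a y
    into-y = a◁y , (a◁y , λ y◁a → y⋬x (inj₁ (trans y◁a a◁x))) , inj₂ refl , inj₂ refl

    outOf-y : OutOf y y b
    outOf-y = y◁b , (inj₂ refl , inj₂ refl) , y◁b , λ b◁y → x⋬y (inj₁ (trans x◁b b◁y))

    -- r = cl (Into x ∪ OutOf x) is regular closed and contains a → x → b,
    -- but every r-edge starts ⊴ x and ends ⊵ x, so neither a → y nor y → b
    -- is in r: r is not open.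
    square⇒¬clopEqReg : ¬ ClopEqReg e
    square⇒¬clopEqReg clopEqReg =
      proj₂ (open-r (a◁y , λ r-ay → x⋬y (ends r-ay)) (y◁b , λ r-yb → y⋬x (starts r-yb))) r-ab
      where
      o : Relation E
      o = Into x ∪ OutOf x
      r : Relation E
      r = cl o
      r-ab : r a b
      r-ab = inj₁ into-x ∷ [ inj₂ outOf-x ]
      starts : ∀ {u v} → r u v → u ⊴ x
      starts [ inj₁ (_ , (u◁x , _) , _) ] = inj₁ u◁x
      starts [ inj₂ (_ , (u⊴x , _) , _) ] = u⊴x
      starts (inj₁ (_ , (u◁x , _) , _) ∷ _) = inj₁ u◁x
      starts (inj₂ (_ , (u⊴x , _) , _) ∷ _) = u⊴x
      ends : ∀ {u v} → r u v → x ⊴ v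
      ends [ inj₁ (_ , _ , (_ , x⊴v)) ] = x⊴v
      ends [ inj₂ (_ , _ , (x◁v , _)) ] = inj₁ x◁v
      ends (_ ∷ rest) = ends rest
      open-o : Open e o
      open-o = ∪-open (proj₂ (proj₂ (Into-clop x))) (proj₂ (proj₂ (OutOf-clop x)))
      open-r : Open e r
      open-r = proj₂ (Equivalence.from (clopEqReg r (cl-least (either proj₁ proj₁) trans))
                                       (cl-open-regular open-o))

    -- Into x and OutOf x avoid Into y and OutOf y, yet a clopen z with
    -- Into x, OutOf x ⊆ z would contain a → b, hence by openness
    -- a → y ∈ Into y or y → b ∈ OutOf y.
    square⇒¬clopInterpolation : ExcludedMiddle 0ℓ → ¬ ClopInterpolation e
    square⇒¬clopInterpolation lem interpolation
      with interpolation (Into x) (OutOf x) (Diff e (Into y)) (Diff e (OutOf y))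
             (Into-clop x) (OutOf-clop x) (∁-clop lem (Into-clop y)) (∁-clop lem (OutOf-clop y))
             (disjoint⇒⊆∁ proj₁ λ i j → x⋬y (Into-Into i j))
             (disjoint⇒⊆∁ proj₁ λ i j → y⋬x (inj₁ (Into-OutOf i j)))
             (disjoint⇒⊆∁ proj₁ λ i j → x⋬y (inj₁ (Into-OutOf j i)))
             (disjoint⇒⊆∁ proj₁ λ i j → x⋬y (OutOf-OutOf i j))
    ... | z , (_ , closed-z , open-z) , into⇒z , z⇒∁into-y , outOf⇒z , z⇒∁outOf-y =
      proj₂ (open-z (a◁y , λ z-ay → proj₂ (z⇒∁into-y z-ay) into-y)
                    (y◁b , λ z-yb → proj₂ (z⇒∁outOf-y z-yb) outOf-y))
            (closed-z (into⇒z into-x) (outOf⇒z outOf-x))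

  clopEqReg⇒squareFree : ExcludedMiddle 0ℓ → ClopEqReg e → SquareFree e
  clopEqReg⇒squareFree lem reg = noSquare⇒squareFree lem λ sq → square⇒¬clopEqReg sq reg

  clopInterpolation⇒squareFree : ExcludedMiddle 0ℓ → ClopInterpolation e → SquareFree e
  clopInterpolation⇒squareFree lem I =
    noSquare⇒squareFree lem λ sq → square⇒¬clopInterpolation sq lem I

theorem4p3 : ExcludedMiddle 0ℓ → ExcludedMiddle (suc 0ℓ) →
    (E : Set) (e : Relation E) → Transitive e →
    (SquareFree e ⇔ ClopEqReg e) × (SquareFree e ⇔ ClopLattice e) × (SquareFree e ⇔ ClopInterpolation e)
theorem4p3 lem₀ lem₁ E e trans =
    mk⇔ (squareFree⇒clopEqReg lem₁) (clopEqReg⇒squareFree lem₀)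
  , mk⇔ (squareFree⇒clopLattice lem₀) (λ lat → iv⇒i (clopLattice⇒clopInterpolation lat))
  , mk⇔ (λ (sf : SquareFree e) → clopLattice⇒clopInterpolation (squareFree⇒clopLattice lem₀ sf))
        iv⇒i
  where
  open SquareFreeness e trans
  iv⇒i : ClopInterpolation e → SquareFree e
  iv⇒i = clopInterpolation⇒squareFree lem₀
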